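{- $\vdash Sx=q+r\ \wedge\ q\text{ is a power of two}\ \wedge\ r<q\ \to\ q=Qx\ \wedge\ r=Rx$.
   Context: PRA (Primitive Recursive Arithmetic) is the quantifier-free formal system whose symbols are variables, PR function symbols, $=$, $\neg$, $\vee$; formulas are built from equations by $\neg,\vee$, with $\wedge,\to,\leftrightarrow$ the usual abbreviations. A function symbol is defined by primitive recursion by $f(\vec x,0)=a$, $f(\vec x,Sy)=b_z(f(\vec x,y))$; PR function symbols are those obtainable from $0$ and $S$ by finitely many such definitions. Axioms: defining equations; $\neg\,Sx=0$; $Sx=Sy\to x=y$; $x=x$; $x=y\to y=x$; $x=y\wedge A_x(x)\to A_x(y)$; propositional axioms $A\vee A\to A$, $A\to A\vee B$, $A\vee B\to B\vee A$, $(B\to C)\to(A\vee B\to A\vee C)$. Rules: instance, modus ponens, induction. $\vdash$ denotes provability in PRA. Symbols: $x+0=x$, $x+Sy=S(x+y)$; $P0=0$, $PSx=x$; $x-0=x$, $x-Sy=P(x-y)$; $C(0,y,z)=y$, $C(Sx,y,z)=z$; $\mathrm{Eq}(x,y)=(x-y)+(y-x)$; $x\mathrel{\dot=}y=C(\mathrm{Eq}(x,y),0,S0)$, $\dot\neg x=C(x,S0,0)$, $x\mathbin{\dot\vee}y=C(x,0,C(y,0,S0))$, $\chi A$ replaces $=,\neg,\vee$ by these. $x\cdot0=0$, $x\cdot Sy=x+x\cdot y$; $x\uparrow0=S0$, $x\uparrow Sy=x\cdot(x\uparrow y)$; $1=S0$, $2=SS0$; $x\le y$ abbreviates $x-y=0$,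 $x<y$ abbreviates $x\le y\wedge x\ne y$. For a formula $B$ in variable $q$ with other variables $\vec y$: $\mu_B(\vec y,0)=C(\chi[B_q(0)],0,S0)$, $\mu_B(\vec y,Sq)=C(\chi[\mu_B(\vec y,q)\le q],\mu_B(\vec y,q),C(\chi[B_q(Sq)],Sq,SSq))$; $\exists q{\le}b\,B$ abbreviates $B_q(\mu_B(\vec y,b))$. "$q$ is a power of two" abbreviates $\exists x{\le}q[2\uparrow x=q]$. $Qx$ abbreviates $\mu_B(x,Sx)$ where $B$ is "$q$ is a power of two $\wedge\ q\le Sx\wedge Sx<2\cdot q$"; it satisfies $\vdash Qx=q\leftrightarrow B$. $Rx=Sx-Qx$. -}

module Defs where

open import Data.Nat using (ℕ; zero; suc; _≡ᵇ_)
open import Data.Fin using (Fin; toℕ) renaming (zero to fz; suc to fs)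
open import Data.Vec using (Vec; []; _∷_; _∷ʳ_; tabulate; lookup)
open import Data.Bool using (if_then_else_)

-- Syntax of PRA.
-- Terms are parametrised by a set V of variables.  PRA proper uses
-- V = ℕ (variable number i); the bodies of primitive-recursive
-- definitions use a finite variable set Fin m.
--
-- PR function symbols (indexed by arity):
--   Z              : the constant 0
--   Suc            : successor S
--   rec n a b      : the symbol f of arity n+1 defined by
--                      f(x⃗,0)  = a
--                      f(x⃗,Sy) = b_z(f(x⃗,y))
--                    where a has variables x₀..x_{n-1}  (Fin n, i ↦ xᵢ),
--                    and b has variables z, y, x₀..x_{n-1}
--                    (Fin (2+n): 0 ↦ z, 1 ↦ y, 2+i ↦ xᵢ).

mutual
  data Fn : ℕ → Set where
    Z   : Fn 0
    Suc : Fn 1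
    rec : (n : ℕ) → Tm (Fin n) → Tm (Fin (suc (suc n))) → Fn (suc n)

  data Tm (V : Set) : Set where
    var : V → Tm V
    app : ∀ {k} → Fn k → Vec (Tm V) k → Tm V

infix  6 _≐_
infixr 4 _∨_
data Fm (V : Set) : Set where
  _≐_ : Tm V → Tm V → Fm V
  ¬'_ : Fm V → Fm V
  _∨_ : Fm V → Fm V → Fm V

infixr 3 _∧_
infixr 2 _⇒_
_⇒_ : ∀ {V} → Fm V → Fm V → Fm V
A ⇒ B = (¬' A) ∨ B

_∧_ : ∀ {V} → Fm V → Fm V → Fm V
A ∧ B = ¬' ((¬' A) ∨ (¬' B))

_⇔_ : ∀ {V} → Fm V → Fm V → Fm V
A ⇔ B = (A ⇒ B) ∧ (B ⇒ A)

mutual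
  sub : ∀ {V W} → (V → Tm W) → Tm V → Tm W
  sub σ (var v)    = σ v
  sub σ (app f ts) = app f (subs σ ts)

  subs : ∀ {V W k} → (V → Tm W) → Vec (Tm V) k → Vec (Tm W) k
  subs σ []       = []
  subs σ (t ∷ ts) = sub σ t ∷ subs σ ts

subF : ∀ {V W} → (V → Tm W) → Fm V → Fm W
subF σ (t ≐ u) = sub σ t ≐ sub σ u
subF σ (¬' A)  = ¬' subF σ A
subF σ (A ∨ B) = subF σ A ∨ subF σ B

[_≔_] : ℕ → Tm ℕ → ℕ → Tm ℕ
[ x ≔ t ] v = if v ≡ᵇ x then t else var v

𝟎 : ∀ {V} → Tm V
𝟎 = app Z []

S : ∀ {V} → Tm V → Tm V
S t = app Suc (t ∷ [])

xsVec : (n : ℕ) → Vec (Tm ℕ) n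
xsVec n = tabulate (λ i → var (toℕ i))

stepσ : (n : ℕ) → Tm ℕ → Fin (suc (suc n)) → Tm ℕ
stepσ n fy fz           = fy
stepσ n fy (fs fz)      = var n
stepσ n fy (fs (fs i))  = var (toℕ i)

defEq0 : (n : ℕ) → Tm (Fin n) → Tm (Fin (suc (suc n))) → Fm ℕ
defEq0 n a b = app (rec n a b) (xsVec n ∷ʳ 𝟎) ≐ sub (λ i → var (toℕ i)) a

defEqS : (n : ℕ) → Tm (Fin n) → Tm (Fin (suc (suc n))) → Fm ℕ
defEqS n a b =
  app (rec n a b) (xsVec n ∷ʳ S (var n))
    ≐ sub (stepσ n (app (rec n a b) (xsVec n ∷ʳ var n))) b

xv yv : Tm ℕ
xv = var 0
yv = var 1

data Axiom : Fm ℕ → Set where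
  ax-def0 : ∀ n a b → Axiom (defEq0 n a b)
  ax-defS : ∀ n a b → Axiom (defEqS n a b)
  ax-S≠0  : Axiom (¬' (S xv ≐ 𝟎))
  ax-Sinj : Axiom ((S xv ≐ S yv) ⇒ (xv ≐ yv))
  ax-refl : Axiom (xv ≐ xv)
  ax-sym  : Axiom ((xv ≐ yv) ⇒ (yv ≐ xv))
  ax-eq   : ∀ (u v : ℕ) (A : Fm ℕ) →
            Axiom (((var u ≐ var v) ∧ A) ⇒ subF [ u ≔ var v ] A)
  ax-p1   : ∀ A → Axiom ((A ∨ A) ⇒ A)
  ax-p2   : ∀ A B → Axiom (A ⇒ (A ∨ B))
  ax-p3   : ∀ A B → Axiom ((A ∨ B) ⇒ (B ∨ A))
  ax-p4   : ∀ A B C → Axiom ((B ⇒ C) ⇒ ((A ∨ B) ⇒ (A ∨ C)))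

infix 1 ⊢_
data ⊢_ : Fm ℕ → Set where
  axiom    : ∀ {A} → Axiom A → ⊢ A
  instance' : ∀ {A} (x : ℕ) (t : Tm ℕ) → ⊢ A → ⊢ subF [ x ≔ t ] A
  mp       : ∀ {A B} → ⊢ A → ⊢ (A ⇒ B) → ⊢ B
  induction : ∀ {A} (x : ℕ) →
              ⊢ subF [ x ≔ 𝟎 ] A →
              ⊢ (A ⇒ subF [ x ≔ S (var x) ] A) →
              ⊢ A

v0 : ∀ {n} → Tm (Fin (suc n))
v0 = var fz
v1 : ∀ {n} → Tm (Fin (suc (suc n)))
v1 = var (fs fz)
v2 : ∀ {n} → Tm (Fin (suc (suc (suc n))))
v2 = var (fs (fs fz))
v3 : ∀ {n} → Tm (Fin (suc (suc (suc (suc n)))))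
v3 = var (fs (fs (fs fz)))

-- x + 0 = x ; x + Sy = S(x+y)
plusF : Fn 2
plusF = rec 1 v0 (S v0)

infixl 8 _+'_
_+'_ : ∀ {V} → Tm V → Tm V → Tm V
s +' t = app plusF (s ∷ t ∷ [])

-- P0 = 0 ; PSx = x
predF : Fn 1
predF = rec 0 𝟎 v1

P : ∀ {V} → Tm V → Tm V
P t = app predF (t ∷ [])

-- x - 0 = x ; x - Sy = P(x - y)
minusF : Fn 2
minusF = rec 1 v0 (P v0)

infixl 8 _-'_
_-'_ : ∀ {V} → Tm V → Tm V → Tm V
s -' t = app minusF (s ∷ t ∷ [])

-- C(0,y,z) = y ; C(Sx,y,z) = z.  Recursion is on the last argument in
-- the scheme, so the symbol C' has argument order (y,z,x) and
-- C(x,y,z) denotes the term C'(y,z,x).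
C'F : Fn 3
C'F = rec 2 v0 v3

C : ∀ {V} → Tm V → Tm V → Tm V → Tm V
C x y z = app C'F (y ∷ z ∷ x ∷ [])

Eq : ∀ {V} → Tm V → Tm V → Tm V
Eq x y = (x -' y) +' (y -' x)

𝟏 𝟐 : ∀ {V} → Tm V
𝟏 = S 𝟎
𝟐 = S (S 𝟎)

_≐̇_ : ∀ {V} → Tm V → Tm V → Tm V
x ≐̇ y = C (Eq x y) 𝟎 𝟏

¬̇ : ∀ {V} → Tm V → Tm V
¬̇ x = C x 𝟏 𝟎

_∨̇_ : ∀ {V} → Tm V → Tm V → Tm V
x ∨̇ y = C x 𝟎 (C y 𝟎 𝟏)

χ : ∀ {V} → Fm V → Tm V
χ (t ≐ u) = t ≐̇ u
χ (¬' A)  = ¬̇ (χ A)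
χ (A ∨ B) = χ A ∨̇ χ B

-- x·0 = 0 ; x·Sy = x + x·y
mulF : Fn 2
mulF = rec 1 𝟎 (v2 +' v0)

infixl 9 _·_
_·_ : ∀ {V} → Tm V → Tm V → Tm V
s · t = app mulF (s ∷ t ∷ [])

-- x↑0 = 1 ; x↑Sy = x·(x↑y)
powF : Fn 2
powF = rec 1 𝟏 (v2 · v0)

infixr 10 _↑_
_↑_ : ∀ {V} → Tm V → Tm V → Tm V
s ↑ t = app powF (s ∷ t ∷ [])

infix 6 _≤'_ _<'_
_≤'_ : ∀ {V} → Tm V → Tm V → Fm V
x ≤' y = (x -' y) ≐ 𝟎

_<'_ : ∀ {V} → Tm V → Tm V → Fm V
x <' y = (x ≤' y) ∧ ¬' (x ≐ y)

-- μ_B for a formula B in variable q (= fz) with other variables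
-- y⃗ = y₀..y_{n-1} (= fs i).  μ_B has arity n+1: μ_B(y⃗, q).
--   μ_B(y⃗,0)  = C(χ[B_q(0)],0,S0)
--   μ_B(y⃗,Sq) = C(χ[μ_B(y⃗,q) ≤ q], μ_B(y⃗,q), C(χ[B_q(Sq)],Sq,SSq))
σ0 : ∀ {n} → Fin (suc n) → Tm (Fin n)
σ0 fz     = 𝟎
σ0 (fs i) = var i

σS : ∀ {n} → Fin (suc n) → Tm (Fin (suc (suc n)))
σS fz     = S v1
σS (fs i) = var (fs (fs i))

μ : (n : ℕ) → Fm (Fin (suc n)) → Fn (suc n)
μ n B = rec n (C (χ (subF σ0 B)) 𝟎 𝟏)
              (C (χ (v0 ≤' v1)) v0 (C (χ (subF σS B)) (S v1) (S (S v1))))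

-- ∃q≤b B  abbreviates  B_q(μ_B(y⃗,b))
σE : ∀ {n W} → Vec (Tm W) n → Tm W → Fin (suc n) → Tm W
σE ys m fz     = m
σE ys m (fs i) = lookup ys i

∃≤ : ∀ {n W} → Fm (Fin (suc n)) → Vec (Tm W) n → Tm W → Fm W
∃≤ {n} B ys b = subF (σE ys (app (μ n B) (ys ∷ʳ b))) B

-- "q is a power of two" := ∃x≤q [2↑x = q]
-- (bound variable x = fz, other variable q = fs fz)
pow2Body : Fm (Fin 2)
pow2Body = (𝟐 ↑ v0) ≐ v1

IsPow2 : ∀ {W} → Tm W → Fm W
IsPow2 q = ∃≤ pow2Body (q ∷ []) q

-- B(q,x) := q is a power of two ∧ q ≤ Sx ∧ Sx < 2·q
-- (q = fz, x = fs fz);   Qx := μ_B(x, Sx);   Rx := Sx - Qx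
QBody : Fm (Fin 2)
QBody = IsPow2 v0 ∧ (v0 ≤' S v1) ∧ (S v1 <' (𝟐 · v0))

Q : ∀ {W} → Tm W → Tm W
Q x = app (μ 1 QBody) (x ∷ S x ∷ [])

R : ∀ {W} → Tm W → Tm W
R x = S x -' Q x

module Submission where

-- Qx is computed by bounded minimisation μ_B over the condition B(q, x): q is a
-- power of two with q ≤ Sx < 2q.  The hypotheses say exactly that the given q
-- satisfies B, so the two basic properties of μ (if some q ≤ b satisfies B then
-- μ_B(x, b) ≤ b, and if μ_B(x, b) ≤ b then μ_B(x, b) satisfies B) show that Qx
-- satisfies B too.  But B has at most one solution: if 2^a < 2^b then
-- 2·2^a ≤ 2^b, so the windows [2^a, 2·2^a) of distinct powers of two are
-- disjoint.  Hence q = Qx, and then r = Sx − q = Rx.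

open import Defs
open import Data.Fin using (Fin)

module Substitution where

  open import Data.Nat using (ℕ; zero; suc; _+_; _⊔_; _≤_; _<_; _≡ᵇ_; _<ᵇ_; s≤s)
  open import Data.Nat.Properties
    using (≤-refl; ≤-trans; m≤m⊔n; m≤n⊔m; <-≤-trans; ≤-<-trans; ≡ᵇ⇒≡; ≡⇒≡ᵇ; <ᵇ⇒<; <⇒<ᵇ; <-cmp; <-asym;
           m≤m+n; m≤n+m; <-irrefl; +-cancelˡ-≡; m≤n⇒m≤1+n; <⇒≤)
  open import Data.Vec using (Vec; []; _∷_)
  open import Data.Bool using (true; false; if_then_else_; T)
  open import Data.Unit using (tt)
  open import Data.Empty using (⊥-elim)
  open import Function using (_∘_)
  open import Relation.Binary.PropositionalEquality
  open import Relation.Nullary using (¬_)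
  open import Relation.Binary.Definitions using (tri<; tri≈; tri>)

  mutual
    sub-∘ : ∀ {U V W} (σ : V → Tm W) (τ : U → Tm V) t → sub σ (sub τ t) ≡ sub (sub σ ∘ τ) t
    sub-∘ σ τ (var v)    = refl
    sub-∘ σ τ (app f ts) = cong (app f) (subs-∘ σ τ ts)

    subs-∘ : ∀ {U V W k} (σ : V → Tm W) (τ : U → Tm V) (ts : Vec (Tm U) k) →
             subs σ (subs τ ts) ≡ subs (sub σ ∘ τ) ts
    subs-∘ σ τ []       = refl
    subs-∘ σ τ (t ∷ ts) = cong₂ _∷_ (sub-∘ σ τ t) (subs-∘ σ τ ts)

  subF-∘ : ∀ {U V W} (σ : V → Tm W) (τ : U → Tm V) A → subF σ (subF τ A) ≡ subF (sub σ ∘ τ) A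
  subF-∘ σ τ (t ≐ u) = cong₂ _≐_ (sub-∘ σ τ t) (sub-∘ σ τ u)
  subF-∘ σ τ (¬' A)  = cong ¬'_ (subF-∘ σ τ A)
  subF-∘ σ τ (A ∨ B) = cong₂ _∨_ (subF-∘ σ τ A) (subF-∘ σ τ B)

  mutual
    sub-cong : ∀ {V W} {σ τ : V → Tm W} → (∀ v → σ v ≡ τ v) → ∀ t → sub σ t ≡ sub τ t
    sub-cong h (var v)    = h v
    sub-cong h (app f ts) = cong (app f) (subs-cong h ts)

    subs-cong : ∀ {V W k} {σ τ : V → Tm W} → (∀ v → σ v ≡ τ v) → (ts : Vec (Tm V) k) →
                subs σ ts ≡ subs τ ts
    subs-cong h []       = refl
    subs-cong h (t ∷ ts) = cong₂ _∷_ (sub-cong h t) (subs-cong h ts)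

  subF-cong : ∀ {V W} {σ τ : V → Tm W} → (∀ v → σ v ≡ τ v) → ∀ A → subF σ A ≡ subF τ A
  subF-cong h (t ≐ u) = cong₂ _≐_ (sub-cong h t) (sub-cong h u)
  subF-cong h (¬' A)  = cong ¬'_ (subF-cong h A)
  subF-cong h (A ∨ B) = cong₂ _∨_ (subF-cong h A) (subF-cong h B)

  mutual
    sub-var : ∀ {V} (t : Tm V) → sub var t ≡ t
    sub-var (var v)    = refl
    sub-var (app f ts) = cong (app f) (subs-var ts)

    subs-var : ∀ {V k} (ts : Vec (Tm V) k) → subs var ts ≡ ts
    subs-var []       = refl
    subs-var (t ∷ ts) = cong₂ _∷_ (sub-var t) (subs-var ts)

  subF-var : ∀ {V} (A : Fm V) → subF var A ≡ A
  subF-var (t ≐ u) = cong₂ _≐_ (sub-var t) (sub-var u)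
  subF-var (¬' A)  = cong ¬'_ (subF-var A)
  subF-var (A ∨ B) = cong₂ _∨_ (subF-var A) (subF-var B)

  χ-sub : ∀ {V W} (σ : V → Tm W) A → sub σ (χ A) ≡ χ (subF σ A)
  χ-sub σ (t ≐ u) = refl
  χ-sub σ (¬' A)  = cong (λ a → C a 𝟏 𝟎) (χ-sub σ A)
  χ-sub σ (A ∨ B) = cong₂ (λ a b → C a 𝟎 (C b 𝟎 𝟏)) (χ-sub σ A) (χ-sub σ B)

  mutual
    varBound : Tm ℕ → ℕ
    varBound (var v)    = suc v
    varBound (app f ts) = varBounds ts

    varBounds : ∀ {k} → Vec (Tm ℕ) k → ℕ
    varBounds []       = 0
    varBounds (t ∷ ts) = varBound t ⊔ varBounds ts

  varBoundF : Fm ℕ → ℕ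
  varBoundF (t ≐ u) = varBound t ⊔ varBound u
  varBoundF (¬' A)  = varBoundF A
  varBoundF (A ∨ B) = varBoundF A ⊔ varBoundF B

  Agree : ∀ {W} → ℕ → (σ τ : ℕ → Tm W) → Set
  Agree N σ τ = ∀ v → v < N → σ v ≡ τ v

  private
    agree-⊔ˡ : ∀ {W} {σ τ : ℕ → Tm W} m n → Agree (m ⊔ n) σ τ → Agree m σ τ
    agree-⊔ˡ m n h v p = h v (≤-trans p (m≤m⊔n m n))

    agree-⊔ʳ : ∀ {W} {σ τ : ℕ → Tm W} m n → Agree (m ⊔ n) σ τ → Agree n σ τ
    agree-⊔ʳ m n h v p = h v (≤-trans p (m≤n⊔m m n))

  mutual
    sub-cong-below : ∀ {W} {σ τ : ℕ → Tm W} t → Agree (varBound t) σ τ → sub σ t ≡ sub τ t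
    sub-cong-below (var v)    h = h v ≤-refl
    sub-cong-below (app f ts) h = cong (app f) (subs-cong-below ts h)

    subs-cong-below : ∀ {W k} {σ τ : ℕ → Tm W} (ts : Vec (Tm ℕ) k) → Agree (varBounds ts) σ τ →
                      subs σ ts ≡ subs τ ts
    subs-cong-below []       h = refl
    subs-cong-below (t ∷ ts) h =
      cong₂ _∷_ (sub-cong-below t (agree-⊔ˡ _ _ h)) (subs-cong-below ts (agree-⊔ʳ _ _ h))

  subF-cong-below : ∀ {W} {σ τ : ℕ → Tm W} A → Agree (varBoundF A) σ τ → subF σ A ≡ subF τ A
  subF-cong-below (t ≐ u) h = cong₂ _≐_ (sub-cong-below t (agree-⊔ˡ _ _ h)) (sub-cong-below u (agree-⊔ʳ _ _ h))
  subF-cong-below (¬' A)  h = cong ¬'_ (subF-cong-below A h)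
  subF-cong-below (A ∨ B) h = cong₂ _∨_ (subF-cong-below A (agree-⊔ˡ _ _ h)) (subF-cong-below B (agree-⊔ʳ _ _ h))

  ≔-same : ∀ x (t : Tm ℕ) → [ x ≔ t ] x ≡ t
  ≔-same x t with x ≡ᵇ x | ≡⇒≡ᵇ x x refl
  ... | true | _ = refl

  ≔-other : ∀ x (t : Tm ℕ) v → ¬ v ≡ x → [ x ≔ t ] v ≡ var v
  ≔-other x t v v≢x with v ≡ᵇ x in eq
  ... | false = refl
  ... | true  = ⊥-elim (v≢x (≡ᵇ⇒≡ v x (subst T (sym eq) tt)))

  sub-fresh : ∀ x t u → varBound u ≤ x → sub [ x ≔ t ] u ≡ u
  sub-fresh x t u bound = trans
    (sub-cong-below u (λ v v<b → ≔-other x t v (λ v≡x → <-irrefl v≡x (<-≤-trans v<b bound))))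
    (sub-var u)

  ⊢-agree : ∀ {σ τ} A → Agree (varBoundF A) σ τ → ⊢ subF σ A → ⊢ subF τ A
  ⊢-agree A h = subst ⊢_ (subF-cong-below A h)

  ⊢-instance : ∀ {A} (τ : ℕ → Tm ℕ) x t → ⊢ subF τ A → ⊢ subF (sub [ x ≔ t ] ∘ τ) A
  ⊢-instance {A} τ x t p = subst ⊢_ (subF-∘ [ x ≔ t ] τ A) (instance' x t p)

  -- Opaque so that σ and τ remain inferable from an application switchAt j σ τ v.
  opaque
    switchAt : ℕ → (ℕ → Tm ℕ) → (ℕ → Tm ℕ) → ℕ → Tm ℕ
    switchAt j σ τ v = if v <ᵇ j then σ v else τ v

    switchAt-< : ∀ {j σ τ v} → v < j → switchAt j σ τ v ≡ σ v
    switchAt-< {j} {v = v} v<j with v <ᵇ j | <⇒<ᵇ v<j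
    ... | true | _ = refl

    switchAt-≮ : ∀ {j σ τ v} → ¬ v < j → switchAt j σ τ v ≡ τ v
    switchAt-≮ {j} {v = v} v≮j with v <ᵇ j in eq
    ... | false = refl
    ... | true  = ⊥-elim (v≮j (<ᵇ⇒< v j (subst T (sym eq) tt)))

  switchAt-suc : ∀ {j σ τ v} → v ≡ j → switchAt (suc j) σ τ v ≡ σ v
  switchAt-suc refl = switchAt-< ≤-refl

  switchAt-≥ : ∀ {j σ τ v} → j < v → switchAt (suc j) σ τ v ≡ τ v
  switchAt-≥ j<v = switchAt-≮ (λ { (s≤s v≤j) → <-irrefl refl (≤-<-trans v≤j j<v) })

  boundOf : (ℕ → Tm ℕ) → ℕ → ℕ
  boundOf σ zero    = 0
  boundOf σ (suc n) = boundOf σ n ⊔ varBound (σ n)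

  boundOf-≥ : ∀ σ {n i} → i < n → varBound (σ i) ≤ boundOf σ n
  boundOf-≥ σ {suc n} {i} (s≤s i≤n) with <-cmp i n
  ... | tri< i<n _ _ = ≤-trans (boundOf-≥ σ i<n) (m≤m⊔n _ _)
  ... | tri≈ _ refl _ = m≤n⊔m _ _
  ... | tri> _ _ i>n = ⊥-elim (<-irrefl refl (≤-<-trans i≤n i>n))

  sweep : ∀ A (τ : ℕ → ℕ → Tm ℕ) (x : ℕ → ℕ) (t : ℕ → Tm ℕ) →
          (∀ j → j < varBoundF A → Agree (varBoundF A) (sub [ x j ≔ t j ] ∘ τ j) (τ (suc j))) →
          ⊢ subF (τ 0) A → ∀ j → j ≤ varBoundF A → ⊢ subF (τ j) A
  sweep A τ x t step p zero    _   = p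
  sweep A τ x t step p (suc j) j<N =
    ⊢-agree A (step j j<N) (⊢-instance (τ j) (x j) (t j) (sweep A τ x t step p j (<⇒≤ j<N)))

  -- A simultaneous substitution σ is simulated by single instances: first each
  -- variable v of A is renamed to the fresh variable K + v, then σ v is
  -- substituted for K + v.  K exceeds every variable of A and of the σ v, so no
  -- later step disturbs an earlier one.
  ⊢-subst : ∀ (σ : ℕ → Tm ℕ) {A} → ⊢ A → ⊢ subF σ A
  ⊢-subst σ {A} ⊢A = ⊢-agree A (λ v v<N → switchAt-< v<N) (sweep A τ (K +_) σ placeStep ⊢τ₀ N ≤-refl)
    where
    N = varBoundF A
    K = N + boundOf σ N

    fresh : ℕ → Tm ℕ
    fresh v = var (K + v)

    ρ : ℕ → ℕ → Tm ℕ
    ρ j = switchAt j fresh var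

    τ : ℕ → ℕ → Tm ℕ
    τ j = switchAt j σ fresh

    via : ∀ {x t a b a' b'} → a ≡ a' → b ≡ b' → sub [ x ≔ t ] a' ≡ b' → sub [ x ≔ t ] a ≡ b
    via refl refl p = p

    renameStep : ∀ j → j < N → Agree N (sub [ j ≔ fresh j ] ∘ ρ j) (ρ (suc j))
    renameStep j j<N v _ with <-cmp v j
    ... | tri< v<j _ _ = via (switchAt-< v<j) (switchAt-< (m≤n⇒m≤1+n v<j))
      (≔-other j _ (K + v) (λ K+v≡j → <-irrefl (sym K+v≡j) (<-≤-trans j<N (≤-trans (m≤m+n N _) (m≤m+n K v)))))
    ... | tri≈ _ refl _ = via (switchAt-≮ (<-irrefl refl)) (switchAt-suc refl) (≔-same j _)
    ... | tri> _ v≢j j<v = via (switchAt-≮ (λ v<j → <-asym v<j j<v)) (switchAt-≥ j<v) (≔-other j _ v v≢j)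

    ⊢ρN : ⊢ subF (ρ N) A
    ⊢ρN = sweep A ρ (λ j → j) fresh renameStep
            (subst ⊢_ (trans (sym (subF-var A)) (subF-cong (λ v → sym (switchAt-≮ λ ())) A)) ⊢A) N ≤-refl

    ⊢τ₀ : ⊢ subF (τ 0) A
    ⊢τ₀ = ⊢-agree A (λ v v<N → trans (switchAt-< v<N) (sym (switchAt-≮ λ ()))) ⊢ρN

    placeStep : ∀ j → j < N → Agree N (sub [ K + j ≔ σ j ] ∘ τ j) (τ (suc j))
    placeStep j j<N v v<N with <-cmp v j
    ... | tri< v<j _ _ = via (switchAt-< v<j) (switchAt-< (m≤n⇒m≤1+n v<j))
      (sub-fresh (K + j) (σ j) (σ v) (≤-trans (boundOf-≥ σ v<N) (≤-trans (m≤n+m _ N) (m≤m+n K j))))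
    ... | tri≈ _ refl _ = via (switchAt-≮ (<-irrefl refl)) (switchAt-suc refl) (≔-same (K + j) _)
    ... | tri> _ v≢j j<v = via (switchAt-≮ (λ v<j → <-asym v<j j<v)) (switchAt-≥ j<v)
      (≔-other (K + j) _ (K + v) (λ K+v≡K+j → v≢j (+-cancelˡ-≡ K v j K+v≡K+j)))

module Propositional where

  open import Data.Nat using (ℕ; zero; suc)
  open import Data.Vec using (Vec; []; _∷_)
  open Substitution using (⊢-subst)

  private variable
    A B D E F : Fm ℕ

  ∨-idem : ⊢ (A ∨ A) ⇒ A
  ∨-idem {A} = axiom (ax-p1 A)

  ∨-inl : ⊢ A ⇒ (A ∨ B)
  ∨-inl {A} {B} = axiom (ax-p2 A B)

  ∨-swap : ⊢ (A ∨ B) ⇒ (B ∨ A)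
  ∨-swap {A} {B} = axiom (ax-p3 A B)

  ∨-monoʳ : ⊢ (B ⇒ D) ⇒ ((A ∨ B) ⇒ (A ∨ D))
  ∨-monoʳ {B} {D} {A} = axiom (ax-p4 A B D)

  ⇒-trans : ⊢ A ⇒ B → ⊢ B ⇒ D → ⊢ A ⇒ D
  ⇒-trans ab bd = mp ab (mp bd ∨-monoʳ)

  ∨-mapʳ : ⊢ A ⇒ B → ⊢ (D ∨ A) ⇒ (D ∨ B)
  ∨-mapʳ ab = mp ab ∨-monoʳ

  ∨-mapˡ : ⊢ A ⇒ B → ⊢ (A ∨ D) ⇒ (B ∨ D)
  ∨-mapˡ ab = ⇒-trans ∨-swap (⇒-trans (∨-mapʳ ab) ∨-swap)

  ∨-elim : ⊢ A ⇒ D → ⊢ B ⇒ D → ⊢ (A ∨ B) ⇒ D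
  ∨-elim ad bd = ⇒-trans (∨-mapˡ ad) (⇒-trans (∨-mapʳ bd) ∨-idem)

  ⇒-refl : ⊢ A ⇒ A
  ⇒-refl = ⇒-trans ∨-inl ∨-idem

  ∨-inr : ⊢ B ⇒ (A ∨ B)
  ∨-inr = ⇒-trans ∨-inl ∨-swap

  ∨-exchange : ⊢ (A ∨ (B ∨ D)) ⇒ (B ∨ (A ∨ D))
  ∨-exchange = ∨-elim (⇒-trans ∨-inl ∨-inr) (∨-mapʳ ∨-inr)

  ∨-assoc : ⊢ (A ∨ (B ∨ D)) ⇒ ((A ∨ B) ∨ D)
  ∨-assoc = ∨-elim (⇒-trans ∨-inl ∨-inl) (∨-elim (⇒-trans ∨-inr ∨-inl) ∨-inr)

  ⇒-contract : ⊢ (A ⇒ (A ⇒ B)) ⇒ (A ⇒ B)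
  ⇒-contract = ⇒-trans ∨-assoc (∨-mapˡ ∨-idem)

  ⇒-distrib : ⊢ (A ⇒ (B ⇒ D)) ⇒ ((A ⇒ B) ⇒ (A ⇒ D))
  ⇒-distrib = ⇒-trans (∨-mapʳ ∨-monoʳ) (⇒-trans ∨-exchange (∨-mapʳ ⇒-contract))

  excluded-middle : ⊢ A ∨ ¬' A
  excluded-middle = mp ⇒-refl ∨-swap

  ¬¬-intro : ⊢ A ⇒ ¬' ¬' A
  ¬¬-intro = excluded-middle

  ¬¬-elim : ⊢ ¬' ¬' A ⇒ A
  ¬¬-elim {A} = mp (mp excluded-middle (mp (¬¬-intro {¬' A}) ∨-monoʳ)) ∨-swap

  -- A derivation from hypotheses H₁, …, Hₙ is a derivation of the iterated
  -- implication H₁ ⇒ (… ⇒ (Hₙ ⇒ A)), so the deduction theorem is definitional.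
  infixl 5 _▸_
  data Ctx : Set where
    ε   : Ctx
    _▸_ : Ctx → Fm ℕ → Ctx

  _⇒*_ : Ctx → Fm ℕ → Fm ℕ
  ε       ⇒* A = A
  (Γ ▸ H) ⇒* A = Γ ⇒* (H ⇒ A)

  infix 1 _⊩_
  record _⊩_ (Γ : Ctx) (A : Fm ℕ) : Set where
    constructor ⟪_⟫
    field derivation : ⊢ (Γ ⇒* A)

  private variable
    Γ : Ctx

  closed : ε ⊩ A → ⊢ A
  closed ⟪ p ⟫ = p

  ⇒I : (Γ ▸ A) ⊩ B → Γ ⊩ A ⇒ B
  ⇒I ⟪ p ⟫ = ⟪ p ⟫

  private
    ⇒I⁻¹ : Γ ⊩ A ⇒ B → (Γ ▸ A) ⊩ B
    ⇒I⁻¹ ⟪ p ⟫ = ⟪ p ⟫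

    lift* : ∀ Γ → ⊢ A → ⊢ (Γ ⇒* A)
    lift* ε       a = a
    lift* (Γ ▸ H) a = lift* Γ (mp a ∨-inr)

    apply* : ∀ Γ → ⊢ A ⇒ B → ⊢ (Γ ⇒* A) → ⊢ (Γ ⇒* B)
    apply* ε       ab a = mp a ab
    apply* (Γ ▸ H) ab a = apply* Γ (∨-mapʳ ab) a

    apply₂* : ∀ Γ → ⊢ A ⇒ (B ⇒ D) → ⊢ (Γ ⇒* A) → ⊢ (Γ ⇒* B) → ⊢ (Γ ⇒* D)
    apply₂* ε       f a b = mp b (mp a f)
    apply₂* (Γ ▸ H) f a b = apply₂* Γ (⇒-trans (∨-mapʳ f) ⇒-distrib) a b

  lift : ⊢ A → Γ ⊩ A
  lift {Γ = Γ} a = ⟪ lift* Γ a ⟫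

  apply : ⊢ A ⇒ B → Γ ⊩ A → Γ ⊩ B
  apply {Γ = Γ} ab ⟪ a ⟫ = ⟪ apply* Γ ab a ⟫

  apply₂ : ⊢ A ⇒ (B ⇒ D) → Γ ⊩ A → Γ ⊩ B → Γ ⊩ D
  apply₂ {Γ = Γ} f ⟪ a ⟫ ⟪ b ⟫ = ⟪ apply₂* Γ f a b ⟫

  ⇒E : Γ ⊩ A ⇒ B → Γ ⊩ A → Γ ⊩ B
  ⇒E = apply₂ ⇒-refl

  weaken : Γ ⊩ A → (Γ ▸ B) ⊩ A
  weaken a = ⇒I⁻¹ (apply ∨-inr a)

  h0 : (Γ ▸ A) ⊩ A
  h0 = ⇒I⁻¹ (lift ⇒-refl)
  h1 : (Γ ▸ A ▸ B) ⊩ A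
  h1 = weaken h0
  h2 : (Γ ▸ A ▸ B ▸ D) ⊩ A
  h2 = weaken h1
  h3 : (Γ ▸ A ▸ B ▸ D ▸ E) ⊩ A
  h3 = weaken h2
  h4 : (Γ ▸ A ▸ B ▸ D ▸ E ▸ F) ⊩ A
  h4 = weaken h3

  ∨E : Γ ⊩ A ∨ B → (Γ ▸ A) ⊩ D → (Γ ▸ B) ⊩ D → Γ ⊩ D
  ∨E ab ad bd = ⇒E (⇒E (⇒E (lift ∨-elim⇒) (⇒I ad)) (⇒I bd)) ab
    where
    ∨-elim⇒ : ⊢ (A ⇒ D) ⇒ ((B ⇒ D) ⇒ ((A ∨ B) ⇒ D))
    ∨-elim⇒ = closed (⇒I (⇒I (⇒I
      (apply ∨-idem (apply₂ ∨-monoʳ h1 (apply ∨-swap (apply₂ ∨-monoʳ h2 (apply ∨-swap h0))))))))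

  ∨I₁ : Γ ⊩ A → Γ ⊩ A ∨ B
  ∨I₁ = apply ∨-inl

  ∨I₂ : Γ ⊩ B → Γ ⊩ A ∨ B
  ∨I₂ = apply ∨-inr

  contradiction : Γ ⊩ A → Γ ⊩ ¬' A → Γ ⊩ B
  contradiction a ¬a = apply₂ ∨-inl ¬a a

  byCases : ∀ A → (Γ ▸ A) ⊩ D → (Γ ▸ ¬' A) ⊩ D → Γ ⊩ D
  byCases A = ∨E (lift excluded-middle)

  ¬I : (Γ ▸ A) ⊩ B → (Γ ▸ A) ⊩ ¬' B → Γ ⊩ ¬' A
  ¬I {A = A} b ¬b = byCases A (contradiction b ¬b) h0

  byContradiction : (Γ ▸ ¬' A) ⊩ B → (Γ ▸ ¬' A) ⊩ ¬' B → Γ ⊩ A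
  byContradiction b ¬b = apply ¬¬-elim (¬I b ¬b)

  ∧I : Γ ⊩ A → Γ ⊩ B → Γ ⊩ A ∧ B
  ∧I a b = ¬I (weaken a) (∨E h0 h0 (contradiction (weaken (weaken b)) h0))

  ∧E₁ : Γ ⊩ A ∧ B → Γ ⊩ A
  ∧E₁ ab = byContradiction (∨I₁ h0) (weaken ab)

  ∧E₂ : Γ ⊩ A ∧ B → Γ ⊩ B
  ∧E₂ ab = byContradiction (∨I₂ h0) (weaken ab)

  modusTollens : Γ ⊩ A ⇒ B → Γ ⊩ ¬' B → Γ ⊩ ¬' A
  modusTollens ab ¬b = ¬I (⇒E (weaken ab) h0) (weaken ¬b)

  disjunctiveSyllogism : Γ ⊩ A ∨ B → Γ ⊩ ¬' A → Γ ⊩ B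
  disjunctiveSyllogism ab ¬a = ∨E ab (contradiction h0 (weaken ¬a)) h0

  ⇔I : (Γ ▸ A) ⊩ B → (Γ ▸ B) ⊩ A → Γ ⊩ A ⇔ B
  ⇔I ab ba = ∧I (⇒I ab) (⇒I ba)

  ⇔E₁ : Γ ⊩ A ⇔ B → Γ ⊩ A → Γ ⊩ B
  ⇔E₁ p = ⇒E (∧E₁ p)

  ⇔E₂ : Γ ⊩ A ⇔ B → Γ ⊩ B → Γ ⊩ A
  ⇔E₂ p = ⇒E (∧E₂ p)

  args : ∀ {n} → Vec (Tm ℕ) n → ℕ → Tm ℕ
  args []       v       = var v
  args (t ∷ ts) zero    = t
  args (t ∷ ts) (suc v) = args ts v

  inst : ∀ {n} (ts : Vec (Tm ℕ) n) → ⊢ A → Γ ⊩ subF (args ts) A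
  inst ts a = lift (⊢-subst (args ts) a)

  induction⊩ : ∀ x A → ε ⊩ subF [ x ≔ 𝟎 ] A → (ε ▸ A) ⊩ subF [ x ≔ S (var x) ] A → ⊢ A
  induction⊩ x A ⟪ base ⟫ ⟪ step ⟫ = induction x base step

module Equality where

  open import Data.Nat using (ℕ)
  open import Data.Vec using (Vec; []; _∷_)
  open Propositional

  private variable
    Γ : Ctx
    r s t u w : Tm ℕ

  V0 V1 V2 V3 : Tm ℕ
  V0 = var 0
  V1 = var 1
  V2 = var 2
  V3 = var 3

  leibniz : ∀ u v A → ⊢ (var u ≐ var v) ⇒ (A ⇒ subF [ u ≔ var v ] A)
  leibniz u v A = closed (⇒I (⇒I (⇒E (lift (axiom (ax-eq u v A))) (∧I h1 h0))))

  ≐-refl : Γ ⊩ t ≐ t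
  ≐-refl {t = t} = inst (t ∷ []) (axiom ax-refl)

  ≐-sym : Γ ⊩ s ≐ t → Γ ⊩ t ≐ s
  ≐-sym {s = s} {t} = ⇒E (inst (s ∷ t ∷ []) (axiom ax-sym))

  ≐-trans : Γ ⊩ s ≐ t → Γ ⊩ t ≐ u → Γ ⊩ s ≐ u
  ≐-trans {s = s} {t} {u} p q = ⇒E (⇒E (inst (s ∷ t ∷ u ∷ []) (leibniz 1 0 (V1 ≐ V2))) (≐-sym p)) q

  infixr 2 _≐⟨_⟩_
  infix  3 _∎
  _≐⟨_⟩_ : ∀ s → Γ ⊩ s ≐ t → Γ ⊩ t ≐ u → Γ ⊩ s ≐ u
  s ≐⟨ p ⟩ q = ≐-trans p q

  _∎ : ∀ s → Γ ⊩ s ≐ s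
  s ∎ = ≐-refl

  private
    -- Variable 9 is a hole for F: it is none of the variables 0–3 used below.
    congAt : ∀ (F : Tm ℕ → Tm ℕ) {n} (ts : Vec (Tm ℕ) n) →
             Γ ⊩ subF (args ts) (subF [ 9 ≔ V0 ] ((V0 ≐ V1) ⇒ ((F (var 9) ≐ F V0) ⇒ subF [ 0 ≔ V1 ] (F (var 9) ≐ F V0))))
    congAt F ts = inst ts (instance' 9 V0 (leibniz 0 1 (F (var 9) ≐ F V0)))

  S-cong : Γ ⊩ s ≐ t → Γ ⊩ S s ≐ S t
  S-cong {s = s} {t} p = ⇒E (⇒E (congAt S (s ∷ t ∷ [])) p) ≐-refl

  P-cong : Γ ⊩ s ≐ t → Γ ⊩ P s ≐ P t
  P-cong {s = s} {t} p = ⇒E (⇒E (congAt P (s ∷ t ∷ [])) p) ≐-refl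

  +'-congʳ : Γ ⊩ s ≐ t → Γ ⊩ s +' u ≐ t +' u
  +'-congʳ {s = s} {t} {u} p = ⇒E (⇒E (congAt (_+' V2) (s ∷ t ∷ u ∷ [])) p) ≐-refl

  +'-congˡ : Γ ⊩ s ≐ t → Γ ⊩ u +' s ≐ u +' t
  +'-congˡ {s = s} {t} {u} p = ⇒E (⇒E (congAt (V2 +'_) (s ∷ t ∷ u ∷ [])) p) ≐-refl

  -'-congʳ : Γ ⊩ s ≐ t → Γ ⊩ s -' u ≐ t -' u
  -'-congʳ {s = s} {t} {u} p = ⇒E (⇒E (congAt (_-' V2) (s ∷ t ∷ u ∷ [])) p) ≐-refl

  -'-congˡ : Γ ⊩ s ≐ t → Γ ⊩ u -' s ≐ u -' t
  -'-congˡ {s = s} {t} {u} p = ⇒E (⇒E (congAt (V2 -'_) (s ∷ t ∷ u ∷ [])) p) ≐-refl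

  ·-congˡ : Γ ⊩ s ≐ t → Γ ⊩ u · s ≐ u · t
  ·-congˡ {s = s} {t} {u} p = ⇒E (⇒E (congAt (V2 ·_) (s ∷ t ∷ u ∷ [])) p) ≐-refl

  ↑-congˡ : Γ ⊩ s ≐ t → Γ ⊩ u ↑ s ≐ u ↑ t
  ↑-congˡ {s = s} {t} {u} p = ⇒E (⇒E (congAt (V2 ↑_) (s ∷ t ∷ u ∷ [])) p) ≐-refl

  C-cong : Γ ⊩ s ≐ t → Γ ⊩ C s u w ≐ C t u w
  C-cong {s = s} {t} {u} {w} p = ⇒E (⇒E (congAt (λ z → C z V2 V3) (s ∷ t ∷ u ∷ w ∷ [])) p) ≐-refl

module Arithmetic where

  open import Data.Vec using ([]; _∷_)
  open import Data.Nat using (ℕ)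
  open Propositional
  open Equality

  private variable
    Γ : Ctx
    r s t : Tm ℕ

  +'-identityʳ : Γ ⊩ t +' 𝟎 ≐ t
  +'-identityʳ {t = t} = inst (t ∷ []) (axiom (ax-def0 1 v0 (S v0)))

  +'-suc : Γ ⊩ s +' S t ≐ S (s +' t)
  +'-suc {s = s} {t} = inst (s ∷ t ∷ []) (axiom (ax-defS 1 v0 (S v0)))

  P-zero : Γ ⊩ P 𝟎 ≐ 𝟎
  P-zero = lift (axiom (ax-def0 0 𝟎 v1))

  P-suc : Γ ⊩ P (S t) ≐ t
  P-suc {t = t} = inst (t ∷ []) (axiom (ax-defS 0 𝟎 v1))

  -'-identityʳ : Γ ⊩ t -' 𝟎 ≐ t
  -'-identityʳ {t = t} = inst (t ∷ []) (axiom (ax-def0 1 v0 (P v0)))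

  -'-suc : Γ ⊩ s -' S t ≐ P (s -' t)
  -'-suc {s = s} {t} = inst (s ∷ t ∷ []) (axiom (ax-defS 1 v0 (P v0)))

  C-zero : Γ ⊩ C 𝟎 s t ≐ s
  C-zero {s = s} {t} = inst (s ∷ t ∷ []) (axiom (ax-def0 2 v0 v3))

  C-suc : Γ ⊩ C (S r) s t ≐ t
  C-suc {r = r} {s} {t} = inst (s ∷ t ∷ r ∷ []) (axiom (ax-defS 2 v0 v3))

  ·-zeroʳ : Γ ⊩ t · 𝟎 ≐ 𝟎
  ·-zeroʳ {t = t} = inst (t ∷ []) (axiom (ax-def0 1 𝟎 (v2 +' v0)))

  ·-suc : Γ ⊩ s · S t ≐ s +' s · t
  ·-suc {s = s} {t} = inst (s ∷ t ∷ []) (axiom (ax-defS 1 𝟎 (v2 +' v0)))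

  ↑-suc : Γ ⊩ s ↑ S t ≐ s · (s ↑ t)
  ↑-suc {s = s} {t} = inst (s ∷ t ∷ []) (axiom (ax-defS 1 𝟏 (v2 · v0)))

  S≢0 : Γ ⊩ ¬' (S t ≐ 𝟎)
  S≢0 {t = t} = inst (t ∷ []) (axiom ax-S≠0)

  1≢0 : Γ ⊩ ¬' (𝟏 ≐ 𝟎)
  1≢0 = S≢0

  +'-identityˡ : Γ ⊩ 𝟎 +' t ≐ t
  +'-identityˡ {t = t} = inst (t ∷ []) schema
    where
    schema : ⊢ 𝟎 +' V0 ≐ V0
    schema = induction⊩ 0 (𝟎 +' V0 ≐ V0) +'-identityʳ (≐-trans +'-suc (S-cong h0))

  +'-sucˡ : Γ ⊩ S s +' t ≐ S (s +' t)
  +'-sucˡ {s = s} {t} = inst (s ∷ t ∷ []) schema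
    where
    schema : ⊢ S V0 +' V1 ≐ S (V0 +' V1)
    schema = induction⊩ 1 (S V0 +' V1 ≐ S (V0 +' V1))
      (≐-trans +'-identityʳ (S-cong (≐-sym +'-identityʳ)))
      (S V0 +' S V1       ≐⟨ +'-suc ⟩
       S (S V0 +' V1)     ≐⟨ S-cong h0 ⟩
       S (S (V0 +' V1))   ≐⟨ S-cong (≐-sym +'-suc) ⟩
       S (V0 +' S V1)     ∎)

  +'-assoc : Γ ⊩ (r +' s) +' t ≐ r +' (s +' t)
  +'-assoc {r = r} {s} {t} = inst (r ∷ s ∷ t ∷ []) schema
    where
    schema : ⊢ (V0 +' V1) +' V2 ≐ V0 +' (V1 +' V2)
    schema = induction⊩ 2 ((V0 +' V1) +' V2 ≐ V0 +' (V1 +' V2))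
      (≐-trans +'-identityʳ (+'-congˡ (≐-sym +'-identityʳ)))
      ((V0 +' V1) +' S V2     ≐⟨ +'-suc ⟩
       S ((V0 +' V1) +' V2)   ≐⟨ S-cong h0 ⟩
       S (V0 +' (V1 +' V2))   ≐⟨ ≐-sym +'-suc ⟩
       V0 +' S (V1 +' V2)     ≐⟨ +'-congˡ (≐-sym +'-suc) ⟩
       V0 +' (V1 +' S V2)     ∎)

  Sm-'Sn≐m-'n : Γ ⊩ S s -' S t ≐ s -' t
  Sm-'Sn≐m-'n {s = s} {t} = inst (s ∷ t ∷ []) schema
    where
    schema : ⊢ S V0 -' S V1 ≐ V0 -' V1
    schema = induction⊩ 1 (S V0 -' S V1 ≐ V0 -' V1)
      (S V0 -' S 𝟎    ≐⟨ -'-suc ⟩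
       P (S V0 -' 𝟎)  ≐⟨ P-cong -'-identityʳ ⟩
       P (S V0)       ≐⟨ P-suc ⟩
       V0             ≐⟨ ≐-sym -'-identityʳ ⟩
       V0 -' 𝟎        ∎)
      (S V0 -' S (S V1)  ≐⟨ -'-suc ⟩
       P (S V0 -' S V1)  ≐⟨ P-cong h0 ⟩
       P (V0 -' V1)      ≐⟨ ≐-sym -'-suc ⟩
       V0 -' S V1        ∎)

  n-'n≐0 : Γ ⊩ t -' t ≐ 𝟎
  n-'n≐0 {t = t} = inst (t ∷ []) schema
    where
    schema : ⊢ V0 -' V0 ≐ 𝟎
    schema = induction⊩ 0 (V0 -' V0 ≐ 𝟎) -'-identityʳ (≐-trans Sm-'Sn≐m-'n h0)

  Sn-'n≐1 : Γ ⊩ S t -' t ≐ 𝟏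
  Sn-'n≐1 {t = t} = inst (t ∷ []) schema
    where
    schema : ⊢ S V0 -' V0 ≐ 𝟏
    schema = induction⊩ 0 (S V0 -' V0 ≐ 𝟏) -'-identityʳ (≐-trans Sm-'Sn≐m-'n h0)

  m+'n-'m≐n : Γ ⊩ (s +' t) -' s ≐ t
  m+'n-'m≐n {s = s} {t} = inst (s ∷ t ∷ []) schema
    where
    schema : ⊢ (V0 +' V1) -' V0 ≐ V1
    schema = induction⊩ 0 ((V0 +' V1) -' V0 ≐ V1)
      (≐-trans -'-identityʳ +'-identityˡ)
      ((S V0 +' V1) -' S V0    ≐⟨ -'-congʳ +'-sucˡ ⟩
       S (V0 +' V1) -' S V0    ≐⟨ Sm-'Sn≐m-'n ⟩
       (V0 +' V1) -' V0        ≐⟨ h0 ⟩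
       V1                      ∎)

  m-'[m+'n]≐0 : Γ ⊩ s -' (s +' t) ≐ 𝟎
  m-'[m+'n]≐0 {s = s} {t} = inst (s ∷ t ∷ []) schema
    where
    schema : ⊢ V0 -' (V0 +' V1) ≐ 𝟎
    schema = induction⊩ 1 (V0 -' (V0 +' V1) ≐ 𝟎)
      (≐-trans (-'-congˡ +'-identityʳ) n-'n≐0)
      (V0 -' (V0 +' S V1)     ≐⟨ -'-congˡ +'-suc ⟩
       V0 -' S (V0 +' V1)     ≐⟨ -'-suc ⟩
       P (V0 -' (V0 +' V1))   ≐⟨ P-cong h0 ⟩
       P 𝟎                    ≐⟨ P-zero ⟩
       𝟎                      ∎)

  [m+'n]-'[m+'o]≐n-'o : Γ ⊩ (r +' s) -' (r +' t) ≐ s -' t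
  [m+'n]-'[m+'o]≐n-'o {r = r} {s} {t} = inst (r ∷ s ∷ t ∷ []) schema
    where
    schema : ⊢ (V0 +' V1) -' (V0 +' V2) ≐ V1 -' V2
    schema = induction⊩ 0 ((V0 +' V1) -' (V0 +' V2) ≐ V1 -' V2)
      (≐-trans (-'-congʳ +'-identityˡ) (-'-congˡ +'-identityˡ))
      ((S V0 +' V1) -' (S V0 +' V2)     ≐⟨ -'-congʳ +'-sucˡ ⟩
       S (V0 +' V1) -' (S V0 +' V2)     ≐⟨ -'-congˡ +'-sucˡ ⟩
       S (V0 +' V1) -' S (V0 +' V2)     ≐⟨ Sm-'Sn≐m-'n ⟩
       (V0 +' V1) -' (V0 +' V2)         ≐⟨ h0 ⟩
       V1 -' V2                         ∎)

  zero-or-suc : Γ ⊩ (t ≐ 𝟎) ∨ (t ≐ S (P t))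
  zero-or-suc {t = t} = inst (t ∷ []) schema
    where
    schema : ⊢ (V0 ≐ 𝟎) ∨ (V0 ≐ S (P V0))
    schema = induction⊩ 0 ((V0 ≐ 𝟎) ∨ (V0 ≐ S (P V0))) (∨I₁ ≐-refl) (∨I₂ (S-cong (≐-sym P-suc)))

  2·n≐n+'n : Γ ⊩ 𝟐 · t ≐ t +' t
  2·n≐n+'n {t = t} = inst (t ∷ []) schema
    where
    schema : ⊢ 𝟐 · V0 ≐ V0 +' V0
    schema = induction⊩ 0 (𝟐 · V0 ≐ V0 +' V0)
      (≐-trans ·-zeroʳ (≐-sym +'-identityʳ))
      (𝟐 · S V0               ≐⟨ ·-suc ⟩
       𝟐 +' 𝟐 · V0            ≐⟨ +'-congˡ h0 ⟩
       𝟐 +' (V0 +' V0)        ≐⟨ +'-sucˡ ⟩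
       S (𝟏 +' (V0 +' V0))    ≐⟨ S-cong +'-sucˡ ⟩
       S (S (𝟎 +' (V0 +' V0))) ≐⟨ S-cong (S-cong +'-identityˡ) ⟩
       S (S (V0 +' V0))       ≐⟨ S-cong (≐-sym +'-sucˡ) ⟩
       S (S V0 +' V0)         ≐⟨ ≐-sym +'-suc ⟩
       S V0 +' S V0           ∎)

module Order where

  open import Data.Vec using ([]; _∷_)
  open import Data.Nat using (ℕ)
  open Propositional
  open Equality
  open Arithmetic

  private variable
    Γ : Ctx
    r s t : Tm ℕ

  difference-dichotomy : Γ ⊩ (t ≐ s +' (t -' s)) ∨ (s ≐ t +' (s -' t))
  difference-dichotomy {t = t} {s} = inst (s ∷ t ∷ []) schema
    where
    Dichotomy : Fm ℕ
    Dichotomy = (V1 ≐ V0 +' (V1 -' V0)) ∨ (V0 ≐ V1 +' (V0 -' V1))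

    Goal : Fm ℕ
    Goal = (V1 ≐ S V0 +' (V1 -' S V0)) ∨ (S V0 ≐ V1 +' (S V0 -' V1))

    d = V1 -' V0

    V1≐V0 : ε ▸ Dichotomy ▸ (V1 ≐ V0 +' d) ▸ (d ≐ 𝟎) ⊩ V1 ≐ V0
    V1≐V0 = V1 ≐⟨ h1 ⟩ V0 +' d ≐⟨ +'-congˡ h0 ⟩ V0 +' 𝟎 ≐⟨ +'-identityʳ ⟩ V0 ∎

    V0≤V1 : ε ▸ Dichotomy ▸ (V1 ≐ V0 +' d) ⊩ Goal
    V0≤V1 = ∨E zero-or-suc
      (∨I₂ (≐-sym
        (V1 +' (S V0 -' V1)  ≐⟨ +'-congʳ V1≐V0 ⟩
         V0 +' (S V0 -' V1)  ≐⟨ +'-congˡ (-'-congˡ V1≐V0) ⟩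
         V0 +' (S V0 -' V0)  ≐⟨ +'-congˡ Sn-'n≐1 ⟩
         V0 +' S 𝟎           ≐⟨ +'-suc ⟩
         S (V0 +' 𝟎)         ≐⟨ S-cong +'-identityʳ ⟩
         S V0                ∎)))
      (∨I₁ (≐-sym
        (S V0 +' (V1 -' S V0)  ≐⟨ +'-congˡ -'-suc ⟩
         S V0 +' P d           ≐⟨ +'-sucˡ ⟩
         S (V0 +' P d)         ≐⟨ ≐-sym +'-suc ⟩
         V0 +' S (P d)         ≐⟨ +'-congˡ (≐-sym h0) ⟩
         V0 +' d               ≐⟨ ≐-sym h1 ⟩
         V1                    ∎)))

    V1≤V0 : ε ▸ Dichotomy ▸ (V0 ≐ V1 +' (V0 -' V1)) ⊩ Goal
    V1≤V0 = ∨I₂ (≐-sym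
      (V1 +' (S V0 -' V1)                 ≐⟨ +'-congˡ (-'-congʳ SV0≐) ⟩
       V1 +' ((V1 +' S (V0 -' V1)) -' V1) ≐⟨ +'-congˡ m+'n-'m≐n ⟩
       V1 +' S (V0 -' V1)                 ≐⟨ ≐-sym SV0≐ ⟩
       S V0                               ∎))
      where
      SV0≐ : ε ▸ Dichotomy ▸ (V0 ≐ V1 +' (V0 -' V1)) ⊩ S V0 ≐ V1 +' S (V0 -' V1)
      SV0≐ = ≐-trans (S-cong h0) (≐-sym +'-suc)

    schema : ⊢ Dichotomy
    schema = induction⊩ 0 Dichotomy
      (∨I₁ (≐-sym (≐-trans (+'-congˡ -'-identityʳ) +'-identityˡ)))
      (∨E h0 V0≤V1 V1≤V0)

  m+'n≐0⇒n≐0 : Γ ⊩ s +' t ≐ 𝟎 → Γ ⊩ t ≐ 𝟎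
  m+'n≐0⇒n≐0 {s = s} {t} s+t≐0 = ∨E zero-or-suc h0
    (contradiction
      (S (s +' P t) ≐⟨ ≐-sym +'-suc ⟩ s +' S (P t) ≐⟨ +'-congˡ (≐-sym h0) ⟩ s +' t ≐⟨ weaken s+t≐0 ⟩ 𝟎 ∎)
      S≢0)

  m+'n≐0⇒m≐0 : Γ ⊩ s +' t ≐ 𝟎 → Γ ⊩ s ≐ 𝟎
  m+'n≐0⇒m≐0 {s = s} {t} s+t≐0 =
    s ≐⟨ ≐-sym +'-identityʳ ⟩ s +' 𝟎 ≐⟨ +'-congˡ (≐-sym (m+'n≐0⇒n≐0 s+t≐0)) ⟩ s +' t ≐⟨ s+t≐0 ⟩ 𝟎 ∎

  m≤'n⇒n≐m+'[n-'m] : Γ ⊩ s ≤' t → Γ ⊩ t ≐ s +' (t -' s)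
  m≤'n⇒n≐m+'[n-'m] {s = s} {t} s≤t = ∨E difference-dichotomy h0 (≐-sym
    (s +' (t -' s)  ≐⟨ +'-congˡ (≐-trans (-'-congʳ (≐-sym s≐t)) n-'n≐0) ⟩
     s +' 𝟎         ≐⟨ +'-identityʳ ⟩
     s              ≐⟨ s≐t ⟩
     t              ∎))
    where
    s≐t : _ ▸ (s ≐ t +' (s -' t)) ⊩ s ≐ t
    s≐t = s ≐⟨ h0 ⟩ t +' (s -' t) ≐⟨ +'-congˡ (weaken s≤t) ⟩ t +' 𝟎 ≐⟨ +'-identityʳ ⟩ t ∎

  m≤'m+'n : Γ ⊩ s ≤' s +' t
  m≤'m+'n = m-'[m+'n]≐0

  ≐⇒≤' : Γ ⊩ s ≐ t → Γ ⊩ s ≤' t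
  ≐⇒≤' s≐t = ≐-trans (-'-congʳ s≐t) n-'n≐0

  ≤'-trans : Γ ⊩ r ≤' s → Γ ⊩ s ≤' t → Γ ⊩ r ≤' t
  ≤'-trans {r = r} {s} {t} r≤s s≤t =
    r -' t                                  ≐⟨ -'-congˡ (≐-trans (m≤'n⇒n≐m+'[n-'m] s≤t) (+'-congʳ (m≤'n⇒n≐m+'[n-'m] r≤s))) ⟩
    r -' ((r +' (s -' r)) +' (t -' s))      ≐⟨ -'-congˡ +'-assoc ⟩
    r -' (r +' ((s -' r) +' (t -' s)))      ≐⟨ m-'[m+'n]≐0 ⟩
    𝟎                                       ∎

  ≤'-total : Γ ⊩ (s ≤' t) ∨ (t ≤' s)
  ≤'-total = ∨E difference-dichotomy
    (∨I₁ (≐-trans (-'-congˡ h0) m-'[m+'n]≐0))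
    (∨I₂ (≐-trans (-'-congˡ h0) m-'[m+'n]≐0))

  ≤'-antisym : Γ ⊩ s ≤' t → Γ ⊩ t ≤' s → Γ ⊩ s ≐ t
  ≤'-antisym {s = s} {t} s≤t t≤s =
    s ≐⟨ m≤'n⇒n≐m+'[n-'m] t≤s ⟩ t +' (s -' t) ≐⟨ +'-congˡ s≤t ⟩ t +' 𝟎 ≐⟨ +'-identityʳ ⟩ t ∎

  n≤'Sn : Γ ⊩ t ≤' S t
  n≤'Sn {t = t} = t -' S t ≐⟨ -'-suc ⟩ P (t -' t) ≐⟨ P-cong n-'n≐0 ⟩ P 𝟎 ≐⟨ P-zero ⟩ 𝟎 ∎

  Sn≰'n : Γ ⊩ ¬' (S t ≤' t)
  Sn≰'n = ¬I (≐-trans (≐-sym Sn-'n≐1) h0) 1≢0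

  n≤'0⇒n≐0 : Γ ⊩ t ≤' 𝟎 → Γ ⊩ t ≐ 𝟎
  n≤'0⇒n≐0 t≤0 = ≐-trans (≐-sym -'-identityʳ) t≤0

  m≤'Sn⇒m≤'n∨m≐Sn : Γ ⊩ s ≤' S t → Γ ⊩ (s ≤' t) ∨ (s ≐ S t)
  m≤'Sn⇒m≤'n∨m≐Sn {s = s} {t} s≤St = byCases (s ≤' t) (∨I₁ h0) (∨E zero-or-suc
    (contradiction h0 h1)
    (∨I₂ (s ≐⟨ s≐S[t+k] ⟩ S (t +' k) ≐⟨ S-cong (+'-congˡ k≐0) ⟩ S (t +' 𝟎) ≐⟨ S-cong +'-identityʳ ⟩ S t ∎)))
    where
    d = s -' t
    k = P d
    Γ' = _ ▸ ¬' (s ≤' t) ▸ (d ≐ S k)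
    s≐S[t+k] : Γ' ⊩ s ≐ S (t +' k)
    s≐S[t+k] = s ≐⟨ m≤'n⇒n≐m+'[n-'m] (disjunctiveSyllogism ≤'-total h1) ⟩
               t +' d ≐⟨ +'-congˡ h0 ⟩ t +' S k ≐⟨ +'-suc ⟩ S (t +' k) ∎
    k≐0 : Γ' ⊩ k ≐ 𝟎
    k≐0 = k                   ≐⟨ ≐-sym m+'n-'m≐n ⟩
          (t +' k) -' t       ≐⟨ ≐-sym Sm-'Sn≐m-'n ⟩
          S (t +' k) -' S t   ≐⟨ -'-congʳ (≐-sym s≐S[t+k]) ⟩
          s -' S t            ≐⟨ weaken (weaken s≤St) ⟩
          𝟎                   ∎

  m<'n⇒Sm≤'n : Γ ⊩ s <' t → Γ ⊩ S s ≤' t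
  m<'n⇒Sm≤'n {s = s} {t} s<t = ∨E zero-or-suc
    (contradiction (≐-sym (t ≐⟨ t≐s+d ⟩ s +' d ≐⟨ +'-congˡ h0 ⟩ s +' 𝟎 ≐⟨ +'-identityʳ ⟩ s ∎)) (weaken (∧E₂ s<t)))
    (S s -' t                ≐⟨ -'-congˡ (t ≐⟨ t≐s+d ⟩ s +' d ≐⟨ +'-congˡ h0 ⟩ s +' S (P d) ≐⟨ +'-suc ⟩
                                          S (s +' P d) ≐⟨ ≐-sym +'-sucˡ ⟩ S s +' P d ∎) ⟩
     S s -' (S s +' P d)     ≐⟨ m-'[m+'n]≐0 ⟩
     𝟎                       ∎)
    where
    d = t -' s
    t≐s+d : ∀ {H} → _ ▸ H ⊩ t ≐ s +' d
    t≐s+d = weaken (m≤'n⇒n≐m+'[n-'m] (∧E₁ s<t))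

  2↑-mono : Γ ⊩ s ≤' t → Γ ⊩ 𝟐 ↑ s ≤' 𝟐 ↑ t
  2↑-mono {s = s} {t} = ⇒E (inst (s ∷ t ∷ []) schema)
    where
    Mono : Fm ℕ
    Mono = (V0 ≤' V1) ⇒ (𝟐 ↑ V0 ≤' 𝟐 ↑ V1)

    schema : ⊢ Mono
    schema = induction⊩ 1 Mono
      (⇒I (≐⇒≤' (↑-congˡ (n≤'0⇒n≐0 h0))))
      (⇒I (∨E (m≤'Sn⇒m≤'n∨m≐Sn h0)
        (≤'-trans (⇒E h2 h0)
          (𝟐 ↑ V1 -' 𝟐 ↑ S V1                ≐⟨ -'-congˡ (≐-trans ↑-suc 2·n≐n+'n) ⟩
           𝟐 ↑ V1 -' (𝟐 ↑ V1 +' 𝟐 ↑ V1)      ≐⟨ m≤'m+'n ⟩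
           𝟎                                 ∎))
        (≐⇒≤' (↑-congˡ h0))))

module Characteristic where

  open import Data.Nat using (ℕ)
  open Propositional
  open Equality
  open Arithmetic
  open Order

  private variable
    Γ : Ctx
    r s t : Tm ℕ
    A : Fm ℕ

  C-≐0 : Γ ⊩ r ≐ 𝟎 → Γ ⊩ C r s t ≐ s
  C-≐0 r≐0 = ≐-trans (C-cong r≐0) C-zero

  C-≢0 : Γ ⊩ ¬' (r ≐ 𝟎) → Γ ⊩ C r s t ≐ t
  C-≢0 r≢0 = ∨E zero-or-suc (contradiction h0 (weaken r≢0)) (≐-trans (C-cong h0) C-suc)

  χ-spec : ∀ A → ⊢ (χ A ≐ 𝟎) ⇔ A
  χ-spec (t ≐ u) = closed (⇔I
    (byCases (Eq t u ≐ 𝟎)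
      (≤'-antisym (m+'n≐0⇒m≐0 h0) (m+'n≐0⇒n≐0 h0))
      (contradiction (≐-trans (≐-sym (C-≢0 h0)) h1) 1≢0))
    (C-≐0
      (Eq t u              ≐⟨ +'-congʳ (≐-trans (-'-congʳ h0) n-'n≐0) ⟩
       𝟎 +' (u -' t)       ≐⟨ +'-congˡ (≐-trans (-'-congʳ (≐-sym h0)) n-'n≐0) ⟩
       𝟎 +' 𝟎              ≐⟨ +'-identityʳ ⟩
       𝟎                   ∎)))
  χ-spec (¬' A) = closed (⇔I
    (¬I (≐-trans (≐-sym (C-≐0 (⇔E₂ (lift (χ-spec A)) h0))) h1) 1≢0)
    (C-≢0 (modusTollens (∧E₁ (lift (χ-spec A))) h0)))
  χ-spec (A ∨ B) = closed (⇔I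
    (byCases (χ A ≐ 𝟎) (∨I₁ (⇔E₁ (lift (χ-spec A)) h0))
      (byCases (χ B ≐ 𝟎) (∨I₂ (⇔E₁ (lift (χ-spec B)) h0))
        (contradiction
          (𝟏 ≐⟨ ≐-sym (C-≢0 h0) ⟩ C (χ B) 𝟎 𝟏 ≐⟨ ≐-sym (C-≢0 h1) ⟩ χ (A ∨ B) ≐⟨ h2 ⟩ 𝟎 ∎)
          1≢0)))
    (∨E h0
      (C-≐0 (⇔E₂ (lift (χ-spec A)) h0))
      (byCases (χ A ≐ 𝟎) (C-≐0 h0) (≐-trans (C-≢0 h0) (C-≐0 (⇔E₂ (lift (χ-spec B)) h1))))))

  if-true : Γ ⊩ A → Γ ⊩ C (χ A) s t ≐ s
  if-true {A = A} a = C-≐0 (⇔E₂ (lift (χ-spec A)) a)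

  if-false : Γ ⊩ ¬' A → Γ ⊩ C (χ A) s t ≐ t
  if-false {A = A} ¬a = C-≢0 (modusTollens (∧E₁ (lift (χ-spec A))) ¬a)

module BoundedMinimisation (B : Fm (Fin 2)) where

  open import Data.Nat using (ℕ)
  open import Data.Fin using (toℕ) renaming (zero to fz; suc to fs)
  open import Data.Vec using ([]; _∷_)
  open import Relation.Binary.PropositionalEquality using (_≡_; refl; trans; cong; cong₂; subst)
  open Substitution using (subF-∘; subF-cong; χ-sub; ⊢-subst)
  open Propositional
  open Equality
  open Arithmetic
  open Order
  open Characteristic

  private variable
    Γ : Ctx
    b q s t y : Tm ℕ

  B⟨_,_⟩ : Tm ℕ → Tm ℕ → Fm ℕ
  B⟨ q , y ⟩ = subF (σE (y ∷ []) q) B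

  -- μ_B(y,b) is the least q ≤ b with B(q,y), and b + 1 if there is none.
  μB : Tm ℕ → Tm ℕ → Tm ℕ
  μB y b = app (μ 1 B) (y ∷ b ∷ [])

  B-sub : ∀ σ q y → subF σ B⟨ q , y ⟩ ≡ B⟨ sub σ q , sub σ y ⟩
  B-sub σ q y = trans (subF-∘ σ (σE (y ∷ []) q) B) (subF-cong (λ { fz → refl ; (fs fz) → refl }) B)

  private
    μ-zero : ⊢ μB V0 𝟎 ≐ C (χ B⟨ 𝟎 , V0 ⟩) 𝟎 𝟏
    μ-zero = subst ⊢_ (cong (λ z → μB V0 𝟎 ≐ C z 𝟎 𝟏) (trans (χ-sub ρ (subF σ0 B)) (cong χ B-sub₀)))
               (axiom (ax-def0 1 _ _))
      where
      ρ : Fin 1 → Tm ℕ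
      ρ i = var (toℕ i)
      B-sub₀ : subF ρ (subF σ0 B) ≡ B⟨ 𝟎 , V0 ⟩
      B-sub₀ = trans (subF-∘ ρ σ0 B) (subF-cong (λ { fz → refl ; (fs fz) → refl }) B)

    μ-suc : ⊢ μB V0 (S V1) ≐ C (χ (μB V0 V1 ≤' V1)) (μB V0 V1) (C (χ B⟨ S V1 , V0 ⟩) (S V1) (S (S V1)))
    μ-suc = subst ⊢_ (cong (λ z → μB V0 (S V1) ≐ C (χ (μB V0 V1 ≤' V1)) (μB V0 V1) (C z (S V1) (S (S V1))))
                          (trans (χ-sub ρ (subF σS B)) (cong χ B-subS)))
              (axiom (ax-defS 1 _ _))
      where
      ρ : Fin 3 → Tm ℕ
      ρ = stepσ 1 (μB V0 V1)
      B-subS : subF ρ (subF σS B) ≡ B⟨ S V1 , V0 ⟩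
      B-subS = trans (subF-∘ ρ σS B) (subF-cong (λ { fz → refl ; (fs fz) → refl }) B)

    induction≡ : ∀ x A {A₀ A₊} → subF [ x ≔ 𝟎 ] A ≡ A₀ → subF [ x ≔ S (var x) ] A ≡ A₊ →
                 ε ⊩ A₀ → (ε ▸ A) ⊩ A₊ → ⊢ A
    induction≡ x A refl refl = induction⊩ x A

  B-resp-≐ : Γ ⊩ s ≐ t → Γ ⊩ B⟨ s , y ⟩ → Γ ⊩ B⟨ t , y ⟩
  B-resp-≐ {s = s} {t} {y} s≐t Bs = ⇒E (⇒E (lift specialised) s≐t) Bs
    where
    schema : ⊢ (V2 ≐ V3) ⇒ (B⟨ V2 , V0 ⟩ ⇒ B⟨ V3 , V0 ⟩)
    schema = subst (λ X → ⊢ (V2 ≐ V3) ⇒ (B⟨ V2 , V0 ⟩ ⇒ X)) (B-sub [ 2 ≔ V3 ] V2 V0) (leibniz 2 3 B⟨ V2 , V0 ⟩)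
    σ = args (y ∷ V1 ∷ s ∷ t ∷ [])
    specialised : ⊢ (s ≐ t) ⇒ (B⟨ s , y ⟩ ⇒ B⟨ t , y ⟩)
    specialised = subst ⊢_ (cong₂ (λ X Y → (s ≐ t) ⇒ (X ⇒ Y)) (B-sub σ V2 V0) (B-sub σ V3 V0)) (⊢-subst σ schema)

  μ-witness : Γ ⊩ μB y b ≤' b → Γ ⊩ B⟨ μB y b , y ⟩
  μ-witness {y = y} {b} = ⇒E (lift specialised)
    where
    m = μB V0 V1
    m₊ = μB V0 (S V1)

    base : ε ▸ (μB V0 𝟎 ≤' 𝟎) ⊩ B⟨ μB V0 𝟎 , V0 ⟩
    base = byCases B⟨ 𝟎 , V0 ⟩
      (B-resp-≐ (≐-sym (≐-trans (lift μ-zero) (if-true h0))) h0)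
      (contradiction
        (𝟏 ≐⟨ ≐-sym (≐-trans (lift μ-zero) (if-false h0)) ⟩ μB V0 𝟎 ≐⟨ ≐-sym -'-identityʳ ⟩ μB V0 𝟎 -' 𝟎 ≐⟨ h1 ⟩ 𝟎 ∎)
        1≢0)

    step : ε ▸ ((m ≤' V1) ⇒ B⟨ m , V0 ⟩) ▸ (m₊ ≤' S V1) ⊩ B⟨ m₊ , V0 ⟩
    step = byCases (m ≤' V1)
      (B-resp-≐ (≐-sym (≐-trans (lift μ-suc) (if-true h0))) (⇒E h2 h0))
      (byCases B⟨ S V1 , V0 ⟩
        (B-resp-≐ (≐-sym (≐-trans (lift μ-suc) (≐-trans (if-false h1) (if-true h0)))) h0)
        (contradiction (≐-trans (-'-congʳ (≐-sym (≐-trans (lift μ-suc) (≐-trans (if-false h1) (if-false h0))))) h2) Sn≰'n))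

    schema : ⊢ (m ≤' V1) ⇒ B⟨ m , V0 ⟩
    schema = induction≡ 1 ((m ≤' V1) ⇒ B⟨ m , V0 ⟩)
      (cong ((μB V0 𝟎 ≤' 𝟎) ⇒_) (B-sub _ _ _)) (cong ((m₊ ≤' S V1) ⇒_) (B-sub _ _ _))
      (⇒I base) (⇒I step)

    σ = args (y ∷ b ∷ [])
    specialised : ⊢ (μB y b ≤' b) ⇒ B⟨ μB y b , y ⟩
    specialised = subst (λ X → ⊢ (μB y b ≤' b) ⇒ X) (B-sub σ m V0) (⊢-subst σ schema)

  μ-bounded : Γ ⊩ B⟨ q , y ⟩ → Γ ⊩ q ≤' b → Γ ⊩ μB y b ≤' b
  μ-bounded {q = q} {y} {b} Bq q≤b = ⇒E (⇒E (lift specialised) Bq) q≤b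
    where
    m = μB V0 V1
    m₊ = μB V0 (S V1)

    base : ε ▸ B⟨ V2 , V0 ⟩ ▸ (V2 ≤' 𝟎) ⊩ μB V0 𝟎 ≤' 𝟎
    base = ≐-trans -'-identityʳ (≐-trans (lift μ-zero) (if-true (B-resp-≐ (n≤'0⇒n≐0 h0) h1)))

    step : ε ▸ (B⟨ V2 , V0 ⟩ ⇒ ((V2 ≤' V1) ⇒ (m ≤' V1))) ▸ B⟨ V2 , V0 ⟩ ▸ (V2 ≤' S V1) ⊩ m₊ ≤' S V1
    step = byCases (m ≤' V1)
      (≐-trans (-'-congʳ (≐-trans (lift μ-suc) (if-true h0))) (≤'-trans h0 n≤'Sn))
      (∨E (m≤'Sn⇒m≤'n∨m≐Sn h1)
        (contradiction (⇒E (⇒E h4 h3) h0) h1)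
        (≐-trans (-'-congʳ (≐-trans (lift μ-suc) (≐-trans (if-false h1) (if-true (B-resp-≐ h0 h3))))) n-'n≐0))

    schema : ⊢ B⟨ V2 , V0 ⟩ ⇒ ((V2 ≤' V1) ⇒ (m ≤' V1))
    schema = induction≡ 1 (B⟨ V2 , V0 ⟩ ⇒ ((V2 ≤' V1) ⇒ (m ≤' V1)))
      (cong (_⇒ ((V2 ≤' 𝟎) ⇒ (μB V0 𝟎 ≤' 𝟎))) (B-sub _ _ _))
      (cong (_⇒ ((V2 ≤' S V1) ⇒ (m₊ ≤' S V1))) (B-sub _ _ _))
      (⇒I (⇒I base)) (⇒I (⇒I step))

    σ = args (y ∷ b ∷ q ∷ [])
    specialised : ⊢ B⟨ q , y ⟩ ⇒ ((q ≤' b) ⇒ (μB y b ≤' b))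
    specialised = subst (λ X → ⊢ X ⇒ ((q ≤' b) ⇒ (μB y b ≤' b))) (B-sub σ V2 V0) (⊢-subst σ schema)

open import Data.Nat using (ℕ)
open Propositional
open Equality
open Arithmetic
open Order
open BoundedMinimisation QBody

private variable
  Γ : Ctx
  a b n p q s t u y : Tm ℕ
  A : Fm ℕ

<'-respˡ-≐ : Γ ⊩ s ≐ t → Γ ⊩ s <' u → Γ ⊩ t <' u
<'-respˡ-≐ s≐t s<u = ∧I (≐-trans (-'-congʳ (≐-sym s≐t)) (∧E₁ s<u)) (¬I (≐-trans (weaken s≐t) h0) (weaken (∧E₂ s<u)))

n<'m⇒m+'n<'2·m : Γ ⊩ t <' s → Γ ⊩ s +' t <' 𝟐 · s
n<'m⇒m+'n<'2·m {t = t} {s} t<s = ∧I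
  ((s +' t) -' 𝟐 · s        ≐⟨ -'-congˡ 2·n≐n+'n ⟩
   (s +' t) -' (s +' s)     ≐⟨ [m+'n]-'[m+'o]≐n-'o ⟩
   t -' s                   ≐⟨ ∧E₁ t<s ⟩
   𝟎                        ∎)
  (¬I
    (t                      ≐⟨ ≐-sym m+'n-'m≐n ⟩
     (s +' t) -' s          ≐⟨ -'-congʳ h0 ⟩
     𝟐 · s -' s             ≐⟨ -'-congʳ 2·n≐n+'n ⟩
     (s +' s) -' s          ≐⟨ m+'n-'m≐n ⟩
     s                      ∎)
    (weaken (∧E₂ t<s)))

2·2↑m≤'2↑n : Γ ⊩ s <' t → Γ ⊩ 𝟐 · (𝟐 ↑ s) ≤' 𝟐 ↑ t
2·2↑m≤'2↑n s<t = ≤'-trans (≐⇒≤' (≐-sym ↑-suc)) (2↑-mono (m<'n⇒Sm≤'n s<t))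

2↑-windows-disjoint : Γ ⊩ 𝟐 ↑ a ≐ p → Γ ⊩ 𝟐 ↑ b ≐ q → Γ ⊩ a <' b → Γ ⊩ q ≤' n → Γ ⊩ n <' 𝟐 · p → Γ ⊩ A
2↑-windows-disjoint 2↑a≐p 2↑b≐q a<b q≤n n<2p =
  contradiction (≤'-antisym (∧E₁ n<2p) 2p≤n) (∧E₂ n<2p)
  where
  2p≤n = ≤'-trans (≐⇒≤' (·-congˡ (≐-sym 2↑a≐p))) (≤'-trans (2·2↑m≤'2↑n a<b) (≤'-trans (≐⇒≤' 2↑b≐q) q≤n))

2↑-window-unique : Γ ⊩ 𝟐 ↑ a ≐ p → Γ ⊩ p ≤' n → Γ ⊩ n <' 𝟐 · p →
                   Γ ⊩ 𝟐 ↑ b ≐ q → Γ ⊩ q ≤' n → Γ ⊩ n <' 𝟐 · q → Γ ⊩ p ≐ q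
2↑-window-unique {a = a} {p} {b = b} {q} 2↑a≐p p≤n n<2p 2↑b≐q q≤n n<2q = byCases (a ≐ b)
  (p ≐⟨ ≐-sym (weaken 2↑a≐p) ⟩ 𝟐 ↑ a ≐⟨ ↑-congˡ h0 ⟩ 𝟐 ↑ b ≐⟨ weaken 2↑b≐q ⟩ q ∎)
  (∨E ≤'-total
    (2↑-windows-disjoint (w 2↑a≐p) (w 2↑b≐q) (∧I h0 h1) (w q≤n) (w n<2p))
    (2↑-windows-disjoint (w 2↑b≐q) (w 2↑a≐p) (∧I h0 (¬I (≐-sym h0) h2)) (w p≤n) (w n<2q)))
  where
  w : ∀ {X H₁ H₂} → Γ ⊩ X → Γ ▸ H₁ ▸ H₂ ⊩ X
  w x = weaken (weaken x)

-- For B = QBody, B⟨ q , x ⟩ is IsPow2 q ∧ q ≤ Sx ∧ Sx < 2q and Qx = μB x (Sx); IsPow2 q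
-- itself unfolds to 2 ↑ e ≐ q, with e the bounded-search term for the exponent.
Q-window-unique : Γ ⊩ B⟨ p , y ⟩ → Γ ⊩ B⟨ q , y ⟩ → Γ ⊩ p ≐ q
Q-window-unique Bp Bq =
  2↑-window-unique (∧E₁ Bp) (∧E₁ (∧E₂ Bp)) (∧E₂ (∧E₂ Bp)) (∧E₁ Bq) (∧E₁ (∧E₂ Bq)) (∧E₂ (∧E₂ Bq))

mainTheorem13 : ⊢ ((S (var 0) ≐ var 1 +' var 2) ∧ IsPow2 (var 1) ∧ (var 2 <' var 1)) ⇒ ((var 1 ≐ Q (var 0)) ∧ (var 2 ≐ R (var 0)))
mainTheorem13 = closed (⇒I (∧I q≐Qx r≐Rx))
  where
  Γ₀ = ε ▸ ((S V0 ≐ V1 +' V2) ∧ IsPow2 V1 ∧ (V2 <' V1))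

  Sx≐q+r : Γ₀ ⊩ S V0 ≐ V1 +' V2
  Sx≐q+r = ∧E₁ h0

  q≤Sx : Γ₀ ⊩ V1 ≤' S V0
  q≤Sx = ≐-trans (-'-congˡ Sx≐q+r) m≤'m+'n

  q-window : Γ₀ ⊩ B⟨ V1 , V0 ⟩
  q-window = ∧I (∧E₁ (∧E₂ h0)) (∧I q≤Sx (<'-respˡ-≐ (≐-sym Sx≐q+r) (n<'m⇒m+'n<'2·m (∧E₂ (∧E₂ h0)))))

  q≐Qx : Γ₀ ⊩ V1 ≐ Q V0
  q≐Qx = Q-window-unique q-window (μ-witness (μ-bounded q-window q≤Sx))

  r≐Rx : Γ₀ ⊩ V2 ≐ R V0
  r≐Rx = V2 ≐⟨ ≐-sym m+'n-'m≐n ⟩ (V1 +' V2) -' V1 ≐⟨ -'-congʳ (≐-sym Sx≐q+r) ⟩ S V0 -' V1 ≐⟨ -'-congˡ q≐Qx ⟩ R V0 ∎
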